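{- Let $A$ be a deterministic tree automaton. For every productive state $p$ of $A$ there exist a state $q$, a path $\pi_p$ from $p$ to $q$, and a pair of branching paths $\pi^0_q,\pi^1_q$, each leading from $q$ to $q$ and each forming an accepting loop.
   Context: A deterministic (parity) tree automaton is $\langle\Sigma,Q,\delta,q_0,\mathrm{rank}\rangle$ with finite alphabet, finite state set, initial state $q_0$, $\mathrm{rank}:Q\to\omega$ and total $\delta:Q\times\Sigma\to Q\times Q$; write $q\stackrel{\sigma,d}{\longrightarrow}q'$ ($d\in\{0,1\}$) if $q'$ is the $d$-th component of $\delta(q,\sigma)$ (0 = left). The run on a full binary tree $t:\{0,1\}^*\to\Sigma$ is $\rho$ with $\rho(\varepsilon)=q_0$, $(\rho(v0),\rho(v1))=\delta(\rho(v),t(v))$; it is accepting iff on every infinite branch the largest rank seen infinitely often is even. A state is productive if it occurs in some accepting run of $A$ (on some tree). A path is a sequence $p_0\stackrel{\sigma_1,d_1}{\longrightarrow}p_1\cdots\stackrel{\sigma_n,d_n}{\longrightarrow}p_n$ ($n\ge0$); a loop is a path with $n\ge1$ and $p_n=p_0$, accepting iff $\max_i\mathrm{rank}(p_i)$ is even. Two paths from the same state with labels $(\sigma'_j,d'_j)_{j\le m}$ and $(\sigma''_j,d''_j)_{j\le n}$ are branching if there is $i\le\min(m,n)$ with $(\sigma'_j,d'_j)=(\sigma''_j,d''_j)$ for all $j<i$, $\sigma'_i=\sigma''_i$ and $d'_i\ne d''_i$. -}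

module Defs where

open import Data.Nat using (ℕ; zero; suc; _≤_; _⊔_)
open import Data.Nat.Divisibility using (_∣_)
open import Data.Fin using (Fin)
open import Data.Bool using (Bool; true; false)
open import Data.List using (List; []; _∷_; _++_; map; foldr; take)
open import Data.Product using (_×_; _,_; proj₁; proj₂; ∃; ∃-syntax; Σ-syntax)
open import Relation.Binary.PropositionalEquality using (_≡_; _≢_)

-- Direction: false = 0 = left, true = 1 = right.
Dir : Set
Dir = Bool

sel : {A : Set} → Dir → A × A → A
sel false (a , b) = a
sel true  (a , b) = b

record Automaton : Set where
  field
    nΣ    : ℕ
    nQ    : ℕ
    δ     : Fin nQ → Fin nΣ → Fin nQ × Fin nQ
    q₀    : Fin nQ
    rank  : Fin nQ → ℕ

module _ (A : Automaton) where
  open Automaton A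

  Letter : Set
  Letter = Fin nΣ

  State : Set
  State = Fin nQ

  Tree : Set
  Tree = List Dir → Letter

  -- the (unique) run of A on t; nodes are words read from the root,
  -- implemented via reversed words for structural recursion
  runRev : Tree → List Dir → State
  runRevAux : Tree → List Dir → State
  runRev t v = runRevAux t v
  runRevAux t [] = q₀
  runRevAux t (d ∷ v) = sel d (δ (runRevAux t v) (t (Data.List.reverse v)))

  run : Tree → List Dir → State
  run t v = runRev t (Data.List.reverse v)

  Branch : Set
  Branch = ℕ → Dir

  prefix : Branch → ℕ → List Dir
  prefix β zero = []
  prefix β (suc n) = prefix β n ++ (β n ∷ [])

  Even : ℕ → Set
  Even n = 2 ∣ n

  LimsupIs : (ℕ → State) → ℕ → Set
  LimsupIs s r =
    ((N : ℕ) → ∃[ n ] (N ≤ n × rank (s n) ≡ r)) ×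
    (∃[ N ] ((n : ℕ) → N ≤ n → rank (s n) ≤ r))

  ParityAccepting : (ℕ → State) → Set
  ParityAccepting s = ∃[ r ] (LimsupIs s r × Even r)

  AcceptingRun : Tree → Set
  AcceptingRun t = (β : Branch) → ParityAccepting (λ n → run t (prefix β n))

  Productive : State → Set
  Productive p = ∃[ t ] (AcceptingRun t × ∃[ v ] (run t v ≡ p))

  -- a path from p is given by its label sequence (σ₁,d₁)…(σₙ,dₙ);
  -- by determinism the visited states are determined by p
  Label : Set
  Label = Letter × Dir

  step : State → Label → State
  step q (σ , d) = sel d (δ q σ)

  target : State → List Label → State
  target q [] = q
  target q (l ∷ w) = target (step q l) w

  states : State → List Label → List State
  states q [] = q ∷ []
  states q (l ∷ w) = q ∷ states (step q l) w

  maxRank : List State → ℕ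
  maxRank qs = foldr (λ q m → rank q ⊔ m) 0 qs

  PathFromTo : State → State → List Label → Set
  PathFromTo p q w = target p w ≡ q

  AcceptingLoop : State → List Label → Set
  AcceptingLoop q w = (∃[ l ] ∃[ w' ] (w ≡ l ∷ w')) × target q w ≡ q × Even (maxRank (states q w))

  Branching : List Label → List Label → Set
  Branching w₁ w₂ = ∃[ u ] ∃[ σ ] ∃[ d₁ ] ∃[ d₂ ] ∃[ r₁ ] ∃[ r₂ ]
    (w₁ ≡ u ++ ((σ , d₁) ∷ r₁) × w₂ ≡ u ++ ((σ , d₂) ∷ r₂) × d₁ ≢ d₂)

module Submission where

-- Let K be a set of pairs (q, σ) for which an accepting loop from q starting with (σ, left) is
-- known. Below p in an accepting run, follow the branch that moves right at state q reading σ
-- exactly when (q, σ) ∈ K. This branch is accepting, so some state whose rank is the limsup r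
-- recurs after all ranks have dropped to ≤ r: between two such visits lies an accepting loop.
-- If its first step (σ, d) has (q, σ) ∈ K, then d is right and it branches off the known left
-- loop; otherwise it is a new left loop and K grows, which can only happen finitely often.

open import Defs
open import Data.Product using (_×_; ∃-syntax; _,_; proj₁; proj₂)
open import Data.Sum using (inj₁; inj₂)
open import Data.Nat using (ℕ; zero; suc; _+_; _*_; _≤_; _<_; z≤n)
open import Data.Nat.Properties
open import Data.Fin using (Fin; toℕ; combine)
open import Data.Fin.Properties using (pigeonhole; combine-injective)
open import Data.Fin.Subset using (Subset; _∈_; _∉_; _∪_; ⁅_⁆; _⊂_; _⊃_; ⊥)
open import Data.Fin.Subset.Properties using (_∈?_; ∉⊥; p⊆p∪q; x∈p∪q⁺; x∈p∪q⁻; x∈⁅x⁆; x∈⁅y⁆⇒x≡y)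
open import Data.Fin.Subset.Induction using (Acc; acc; ⊃-wellFounded)
open import Data.Bool using (true; false)
open import Data.List using (List; []; _∷_; _++_; [_]; _∷ʳ_; length; reverse)
open import Data.List.Properties using (reverse-++; reverse-involutive; ++-assoc; ++-identityʳ)
open import Relation.Nullary using (yes; no; does; contradiction)
open import Relation.Binary.PropositionalEquality using (_≡_; refl; sym; trans; cong; subst; module ≡-Reasoning)

strictly-increasing⇒monotone : (f : ℕ → ℕ) → (∀ i → f i < f (suc i)) → ∀ {i j} → i < j → f i < f j
strictly-increasing⇒monotone f inc {i} {suc j} i<1+j with m≤n⇒m<n∨m≡n (≤-pred i<1+j)
... | inj₁ i<j  = <-trans (strictly-increasing⇒monotone f inc i<j) (inc j)
... | inj₂ refl = inc i

module _ {P : ℕ → Set} (often : ∀ N → ∃[ n ] (N ≤ n × P n)) (N : ℕ) where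

  occurrence : ℕ → ℕ
  occurrence zero    = proj₁ (often N)
  occurrence (suc i) = proj₁ (often (suc (occurrence i)))

  occurrence-≥ : ∀ i → N ≤ occurrence i
  occurrence-≥ zero    = proj₁ (proj₂ (often N))
  occurrence-≥ (suc i) = ≤-trans (m≤n⇒m≤1+n (occurrence-≥ i)) (proj₁ (proj₂ (often (suc (occurrence i)))))

  occurrence-holds : ∀ i → P (occurrence i)
  occurrence-holds zero    = proj₂ (proj₂ (often N))
  occurrence-holds (suc i) = proj₂ (proj₂ (often (suc (occurrence i))))

  occurrence-< : ∀ i → occurrence i < occurrence (suc i)
  occurrence-< i = proj₁ (proj₂ (often (suc (occurrence i))))

  -- Infinite pigeonhole principle: apply the finite one to the first m + 1 occurrences.
  recurrent-repeat : ∀ {m} (f : ℕ → Fin m) → ∃[ a ] ∃[ k ] (N ≤ a × P a × f a ≡ f (suc k + a))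
  recurrent-repeat {m} f with pigeonhole (n<1+n m) (λ i → f (occurrence (toℕ i)))
  ... | i , j , i<j , same with m≤n⇒∃[o]m+o≡n (strictly-increasing⇒monotone occurrence occurrence-< i<j)
  ...   | k , a+1+k≡b =
    a , k , occurrence-≥ (toℕ i) , occurrence-holds (toℕ i) ,
    trans same (cong f (sym (trans (cong suc (+-comm k a)) a+1+k≡b)))
    where a = occurrence (toℕ i)

x∉p⇒p⊂p∪⁅x⁆ : ∀ {n} {p : Subset n} {x} → x ∉ p → p ⊂ p ∪ ⁅ x ⁆
x∉p⇒p⊂p∪⁅x⁆ {x = x} x∉p = p⊆p∪q ⁅ x ⁆ , x , x∈p∪q⁺ (inj₂ (x∈⁅x⁆ x)) , x∉p

infixr 5 _∷ᵇ_ _++ᵇ_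

_∷ᵇ_ : Dir → (ℕ → Dir) → ℕ → Dir
(d ∷ᵇ β) zero    = d
(d ∷ᵇ β) (suc n) = β n

_++ᵇ_ : List Dir → (ℕ → Dir) → ℕ → Dir
[]      ++ᵇ β = β
(d ∷ v) ++ᵇ β = d ∷ᵇ (v ++ᵇ β)

module _ (A : Automaton) where
  open Automaton A

  prefix-∷ᵇ : ∀ d β n → prefix A (d ∷ᵇ β) (suc n) ≡ d ∷ prefix A β n
  prefix-∷ᵇ d β zero    = refl
  prefix-∷ᵇ d β (suc n) = cong (_∷ʳ β n) (prefix-∷ᵇ d β n)

  prefix-++ᵇ : ∀ v β n → prefix A (v ++ᵇ β) (length v + n) ≡ v ++ prefix A β n
  prefix-++ᵇ []      β n = refl
  prefix-++ᵇ (d ∷ v) β n = trans (prefix-∷ᵇ d (v ++ᵇ β) (length v + n)) (cong (d ∷_) (prefix-++ᵇ v β n))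

  run-∷ʳ : ∀ t x d → run A t (x ∷ʳ d) ≡ step A (run A t x) (t x , d)
  run-∷ʳ t x d = begin
    runRevAux A t (reverse (x ∷ʳ d))                     ≡⟨ cong (runRevAux A t) (reverse-++ x [ d ]) ⟩
    sel d (δ (run A t x) (t (reverse (reverse x))))     ≡⟨ cong (λ y → sel d (δ (run A t x) (t y))) (reverse-involutive x) ⟩
    step A (run A t x) (t x , d)                         ∎
    where open ≡-Reasoning

  ParityAccepting-suffix : ∀ {s s'} k → (∀ n → s' n ≡ s (k + n)) → ParityAccepting A s → ParityAccepting A s'
  ParityAccepting-suffix {s} {s'} k s'≡s (r , (often , N , eventually≤) , even) =
    r , (often' , N , eventually≤') , even
    where
    often' : ∀ M → ∃[ n ] (M ≤ n × rank (s' n) ≡ r)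
    often' M with often (k + M)
    ... | n , k+M≤n , rank≡r with m≤n⇒∃[o]m+o≡n k+M≤n
    ...   | o , k+M+o≡n =
      M + o , m≤m+n M o ,
      trans (cong rank (trans (s'≡s (M + o)) (cong s (trans (sym (+-assoc k M o)) k+M+o≡n)))) rank≡r
    eventually≤' : ∀ n → N ≤ n → rank (s' n) ≤ r
    eventually≤' n N≤n = subst (_≤ r) (cong rank (sym (s'≡s n))) (eventually≤ (k + n) (≤-trans N≤n (m≤n+m n k)))

  rank≤maxRank-states : ∀ q w → rank q ≤ maxRank A (states A q w)
  rank≤maxRank-states q []      = m≤m⊔n (rank q) 0
  rank≤maxRank-states q (l ∷ w) = m≤m⊔n (rank q) _

  module InfinitePath (s : ℕ → State A) (lab : ℕ → Label A) (follows : ∀ n → s (suc n) ≡ step A (s n) (lab n)) where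

    segment : ℕ → ℕ → List (Label A)
    segment i zero    = []
    segment i (suc k) = lab i ∷ segment (suc i) k

    target-segment : ∀ i k → target A (s i) (segment i k) ≡ s (k + i)
    target-segment i zero    = refl
    target-segment i (suc k) = begin
      target A (step A (s i) (lab i)) (segment (suc i) k) ≡⟨ cong (λ q → target A q (segment (suc i) k)) (sym (follows i)) ⟩
      target A (s (suc i)) (segment (suc i) k)            ≡⟨ target-segment (suc i) k ⟩
      s (k + suc i)                                       ≡⟨ cong s (+-suc k i) ⟩
      s (suc k + i)                                       ∎
      where open ≡-Reasoning

    maxRank-segment-≤ : ∀ {r i} → (∀ n → i ≤ n → rank (s n) ≤ r) → ∀ k → maxRank A (states A (s i) (segment i k)) ≤ r
    maxRank-segment-≤ {i = i} bound zero    = ⊔-lub (bound i ≤-refl) z≤n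
    maxRank-segment-≤ {r} {i} bound (suc k) =
      ⊔-lub (bound i ≤-refl)
        (subst (λ q → maxRank A (states A q (segment (suc i) k)) ≤ r) (follows i)
          (maxRank-segment-≤ (λ n i<n → bound n (<⇒≤ i<n)) k))

    accepting⇒loop : ParityAccepting A s → ∃[ a ] ∃[ k ] AcceptingLoop A (s a) (segment a (suc k))
    accepting⇒loop (r , (often , N , eventually≤) , even) with recurrent-repeat often N s
    ... | a , k , N≤a , rank≡r , repeat =
      a , k , (lab a , segment (suc a) k , refl) , trans (target-segment a (suc k)) (sym repeat) ,
      subst (Even A) (sym maxRank≡r) even
      where
      maxRank≡r : maxRank A (states A (s a) (segment a (suc k))) ≡ r
      maxRank≡r = ≤-antisym (maxRank-segment-≤ (λ n a≤n → eventually≤ n (≤-trans N≤a a≤n)) (suc k))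
                            (subst (_≤ _) rank≡r (rank≤maxRank-states (s a) (segment a (suc k))))

  ReachableLoopStartingBy : (State A → Letter A → Dir) → State A → Set
  ReachableLoopStartingBy choose p =
    ∃[ q ] ∃[ π ] ∃[ σ ] ∃[ w ] (PathFromTo A p q π × AcceptingLoop A q ((σ , choose q σ) ∷ w))

  module StrategyBranch (t : Tree A) (v : List Dir) (choose : State A → Letter A → Dir) where

    next : List Dir → Dir
    next w = choose (run A t w) (t w)

    node : ℕ → List Dir
    node zero    = v
    node (suc n) = node n ∷ʳ next (node n)

    direction : ℕ → Dir
    direction n = next (node n)

    node≡v++prefix : ∀ n → node n ≡ v ++ prefix A direction n
    node≡v++prefix zero    = sym (++-identityʳ v)
    node≡v++prefix (suc n) =
      trans (cong (_∷ʳ direction n) (node≡v++prefix n)) (++-assoc v (prefix A direction n) [ direction n ])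

    open InfinitePath (λ n → run A t (node n)) (λ n → t (node n) , direction n)
                      (λ n → run-∷ʳ t (node n) (direction n)) public

    accepting-branch : AcceptingRun A t → ParityAccepting A (λ n → run A t (node n))
    accepting-branch accepting = ParityAccepting-suffix (length v)
      (λ n → cong (run A t) (trans (node≡v++prefix n) (sym (prefix-++ᵇ v direction n)))) (accepting (v ++ᵇ direction))

  reachable-loop : ∀ {t} → AcceptingRun A t → ∀ v choose → ReachableLoopStartingBy choose (run A t v)
  reachable-loop {t} accepting v choose =
    let a , k , loop = accepting⇒loop (accepting-branch accepting)
    in  run A t (node a) , segment 0 a , t (node a) , segment (suc a) k ,
        trans (target-segment 0 a) (cong (λ n → run A t (node n)) (+-identityʳ a)) , loop
    where open StrategyBranch t v choose

  LeftLoop : State A → Letter A → Set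
  LeftLoop q σ = ∃[ w ] AcceptingLoop A q ((σ , false) ∷ w)

  -- Pairs are encoded in Fin (nQ * nΣ) so that sets of them are Subsets, well-founded under ⊃.
  key : State A → Letter A → Fin (nQ * nΣ)
  key = combine

  LeftLoopsFor : Subset (nQ * nΣ) → Set
  LeftLoopsFor K = ∀ q σ → key q σ ∈ K → LeftLoop q σ

  LeftLoopsFor-∪⁅⁆ : ∀ {K q σ} → LeftLoopsFor K → LeftLoop q σ → LeftLoopsFor (K ∪ ⁅ key q σ ⁆)
  LeftLoopsFor-∪⁅⁆ {K} {q} {σ} loops loop q' σ' q'σ'∈ with x∈p∪q⁻ K ⁅ key q σ ⁆ q'σ'∈
  ... | inj₁ q'σ'∈K  = loops q' σ' q'σ'∈K
  ... | inj₂ q'σ'∈⁅⁆ with combine-injective q' σ' q σ (x∈⁅y⁆⇒x≡y (key q σ) q'σ'∈⁅⁆)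
  ...   | refl , refl = loop

  BranchingLoopsReachable : State A → Set
  BranchingLoopsReachable p = ∃[ q ] ∃[ πp ] ∃[ π0 ] ∃[ π1 ]
    (PathFromTo A p q πp × AcceptingLoop A q π0 × AcceptingLoop A q π1 × Branching A π0 π1)

  branching-loops : ∀ {p} → (∀ choose → ReachableLoopStartingBy choose p) →
                    ∀ K → Acc _⊃_ K → LeftLoopsFor K → BranchingLoopsReachable p
  branching-loops loops K (acc larger) left with loops (λ q σ → does (key q σ ∈? K))
  ... | q , π , σ , w , path , loop with key q σ ∈? K
  ...   | yes known = let w' , left-loop = left q σ known in
    q , π , (σ , false) ∷ w' , (σ , true) ∷ w , path , left-loop , loop ,
    ([] , σ , false , true , w' , w , refl , refl , λ ())
  ...   | no new =
    branching-loops loops (K ∪ ⁅ key q σ ⁆) (larger (x∉p⇒p⊂p∪⁅x⁆ new)) (LeftLoopsFor-∪⁅⁆ left (w , loop))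

lemma12p1 : (A : Automaton) (p : State A) → Productive A p →
    ∃[ q ] ∃[ πp ] ∃[ π0 ] ∃[ π1 ]
    (PathFromTo A p q πp × AcceptingLoop A q π0 × AcceptingLoop A q π1 × Branching A π0 π1)
lemma12p1 A _ (t , accepting , v , refl) =
  branching-loops A (reachable-loop A accepting v) ⊥ (⊃-wellFounded ⊥) (λ _ _ ∈⊥ → contradiction ∈⊥ ∉⊥)
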